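{- Let $n\ge1$ and let $K$ be a pure $n$-simplicial complex with set of $n$-simplices $K^n$. Then there exists a partition $\mathcal{L}$ of $K^n$ such that $\overline{L_i}$ is a component of $K$ for each $L_i\in\mathcal{L}$.
   Context: A simplicial complex on a finite vertex set is a collection of non-empty vertex subsets containing all singletons and closed under non-empty subsets; a $k$-simplex has $k+1$ vertices; $\tau$ is a face of $\sigma$ if $\tau\subseteq\sigma$. $K$ is a pure $n$-simplicial complex if $\dim K=n$ and every simplex is a face of some $n$-simplex. For a set $S$ of simplices, $\overline{S}$ is the set of all faces of members of $S$. An $(n-1,n)$-walk sequence is an alternating sequence $\sigma_1,\eta_1,\sigma_2,\dots,\sigma_r,\eta_r,\sigma_{r+1}$ of $(n-1)$-simplices $\sigma_k$ and $n$-simplices $\eta_k$ with $\sigma_k\ne\sigma_{k+1}$ both faces of $\eta_k$; it is an $(n-1,n)$-path sequence if all its simplices are distinct. A pure $n$-simplicial complex is connected if there is an $(n-1,n)$-path sequence (within it) between every pair of distinct $(n-1)$-simplices of it, and disconnected otherwise. A component of $K$ is a subcomplex $L$ of $K$ which is a pure $n$-simplicial complex, is connected, and such that for every $n$-simplex $\eta\in K^n\setminus L^n$ the complex $L\cup\overline{\{\eta\}}$ is disconnected. -}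

module Defs where

open import Level using (0ℓ)
open import Data.Nat using (ℕ; zero; suc; _≤_)
open import Data.Fin using (Fin; zero; suc; inject₁; fromℕ)
open import Data.Fin.Subset using (Subset; _⊆_; ∣_∣; Nonempty; ⁅_⁆)
open import Data.Product using (Σ; ∃; _×_; _,_)
open import Data.Sum using (_⊎_)
open import Relation.Nullary using (¬_)
open import Relation.Binary.PropositionalEquality using (_≡_; _≢_)
open import Relation.Unary using (Pred)
open import Function.Definitions using (Injective)

SimplexSet : ℕ → Set₁
SimplexSet m = Pred (Subset m) 0ℓ

_IsDim_ : ∀ {m} → Subset m → ℕ → Set
σ IsDim k = ∣ σ ∣ ≡ suc k

IsClosedFamily : ∀ {m} → SimplexSet m → Set
IsClosedFamily {m} K =
  (∀ σ → K σ → Nonempty σ) ×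
  (∀ σ τ → K σ → Nonempty τ → τ ⊆ σ → K τ)

IsSimplicialComplex : ∀ {m} → SimplexSet m → Set
IsSimplicialComplex {m} K = IsClosedFamily K × (∀ (i : Fin m) → K ⁅ i ⁆)

IsSubcomplex : ∀ {m} → SimplexSet m → SimplexSet m → Set
IsSubcomplex {m} L K = IsClosedFamily L × (∀ σ → L σ → K σ)

HasDim : ∀ {m} → ℕ → SimplexSet m → Set
HasDim {m} n K = (∃ λ η → K η × η IsDim n) × (∀ σ → K σ → ∣ σ ∣ ≤ suc n)

IsPure : ∀ {m} → ℕ → SimplexSet m → Set
IsPure {m} n K = HasDim n K × (∀ σ → K σ → ∃ λ η → K η × η IsDim n × σ ⊆ η)

closure : ∀ {m} → SimplexSet m → SimplexSet m
closure {m} S σ = Nonempty σ × ∃ λ τ → S τ × σ ⊆ τ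

_∪ₛ_ : ∀ {m} → SimplexSet m → SimplexSet m → SimplexSet m
(A ∪ₛ B) σ = A σ ⊎ B σ

singletonSet : ∀ {m} → Subset m → SimplexSet m
singletonSet η σ = σ ≡ η

-- (n-1,n)-walk sequence in L (here n = suc p, (n-1)-simplices have n vertices):
-- σ_0, η_0, σ_1, ..., η_{r-1}, σ_r
record Walk {m} (n : ℕ) (L : SimplexSet m) : Set where
  field
    r     : ℕ
    σ     : Fin (suc r) → Subset m
    η     : Fin r → Subset m
    σ∈L   : ∀ k → L (σ k)
    σdim  : ∀ k → ∣ σ k ∣ ≡ n
    η∈L   : ∀ k → L (η k)
    ηdim  : ∀ k → η k IsDim n
    step≢ : ∀ k → σ (inject₁ k) ≢ σ (suc k)
    left⊆ : ∀ k → σ (inject₁ k) ⊆ η k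
    right⊆ : ∀ k → σ (suc k) ⊆ η k

-- path sequence: all simplices distinct ((n-1)- and n-simplices differ in size)
IsPath : ∀ {m n} {L : SimplexSet m} → Walk n L → Set
IsPath w = Injective _≡_ _≡_ (Walk.σ w) × Injective _≡_ _≡_ (Walk.η w)

PathBetween : ∀ {m} (n : ℕ) (L : SimplexSet m) → Subset m → Subset m → Set
PathBetween n L a b =
  Σ (Walk n L) λ w → IsPath w × Walk.σ w zero ≡ a × Walk.σ w (fromℕ (Walk.r w)) ≡ b

Connected : ∀ {m} → ℕ → SimplexSet m → Set
Connected {m} n L =
  ∀ a b → L a → ∣ a ∣ ≡ n → L b → ∣ b ∣ ≡ n → a ≢ b → PathBetween n L a b

IsComponent : ∀ {m} → ℕ → SimplexSet m → SimplexSet m → Set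
IsComponent {m} n K L =
  IsSubcomplex L K × IsPure n L × Connected n L ×
  (∀ η → K η → η IsDim n → ¬ L η → ¬ Connected n (L ∪ₛ closure (singletonSet η)))

nSimplices : ∀ {m} → ℕ → SimplexSet m → SimplexSet m
nSimplices n K η = K η × η IsDim n

IsPartition : ∀ {m} (S : SimplexSet m) (k : ℕ) → (Fin k → SimplexSet m) → Set
IsPartition {m} S k L =
  (∀ i → ∃ λ σ → L i σ) ×
  (∀ i σ → L i σ → S σ) ×
  (∀ σ → S σ → ∃ λ i → L i σ) ×
  (∀ i j σ → L i σ → L j σ → i ≡ j)

-- Two n-simplices are adjacent when they share an (n-1)-face; the blocks of the
-- partition are the classes of the equivalence relation generated by adjacency,
-- computed by inserting the n-simplices one at a time and merging every class the
-- new simplex touches. The closure of a class is connected because a chain of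
-- adjacent n-simplices is an (n-1,n)-walk, and loop erasure turns walks into path
-- sequences. It is maximal because a path sequence starting at an (n-1)-face of an
-- outside n-simplex η never leaves η: leaving it would need an n-simplex of the
-- class sharing an (n-1)-face with η, which would then belong to the class.
module Submission where

open import Defs
open import Level using (0ℓ)
open import Function using (_∘_)
open import Data.Bool using () renaming (_≟_ to _≟ᵇ_)
open import Data.Empty using (⊥-elim)
open import Data.Unit using (⊤; tt)
open import Data.Nat using (ℕ; zero; suc; _≤_; s≤s; z≤n; _≟_)
open import Data.Nat.Properties using (≤-trans; ≤-reflexive; suc-injective)
open import Data.Product using (Σ; ∃; ∃₂; _×_; _,_; proj₁; proj₂)
open import Data.Sum using (_⊎_; inj₁; inj₂)
open import Data.Fin using (Fin; zero; suc; inject₁; fromℕ)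
open import Data.Fin.Induction using (<-weakInduction)
open import Data.Fin.Subset using (Subset; inside; outside; _⊆_; ∣_∣; Nonempty)
open import Data.Fin.Subset.Properties
  using (out⊆; ⊆-refl; ⊆-trans; p⊆q⇒∣p∣≤∣q∣; _⊆?_; nonempty?; Empty-unique; ∣⊥∣≡0; anySubset?)
open import Data.Vec using ([]; _∷_)
open import Data.Vec.Properties using (≡-dec)
open import Data.List using (List; []; _∷_; map; _++_; filter; concat; length; lookup)
open import Data.List.Membership.Propositional using (_∈_; _∉_; find; lose)
open import Data.List.Membership.Propositional.Properties
  using (∈-map⁺; ∈-++⁺ˡ; ∈-++⁺ʳ; ∈-filter⁺; ∈-filter⁻; ∈-concat⁺′; ∈-concat⁻′; ∈-lookup)
import Data.List.Membership.DecPropositional as DecMembership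
open import Data.List.Relation.Binary.Subset.Propositional using () renaming (_⊆_ to _⊆ᴸ_)
open import Data.List.Relation.Binary.Disjoint.Propositional using (Disjoint)
open import Data.List.Relation.Unary.Any as Any using (Any; here; there; any?)
open import Data.List.Relation.Unary.Any.Properties using (lookup-index)
import Data.List.Relation.Unary.All as All
open import Data.List.Relation.Unary.AllPairs using (AllPairs; []; _∷_)
import Data.List.Relation.Unary.AllPairs.Properties as AllPairs
open import Relation.Nullary using (yes; no; ¬_; ¬?; contradiction)
open import Relation.Nullary.Decidable using (_×-dec_)
open import Relation.Unary using (Pred; Decidable)
open import Relation.Binary using (Rel; Sym; Symmetric; DecidableEquality)
  renaming (Decidable to Decidable₂)
open import Relation.Binary.PropositionalEquality using (_≡_; _≢_; refl; sym; trans; cong; subst)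
open import Relation.Binary.Construct.Closure.ReflexiveTransitive as Star
  using (Star; ε; _◅_; _◅◅_)
open import Function.Definitions using (Injective)

_≟ˢ_ : ∀ {k} → DecidableEquality (Subset k)
_≟ˢ_ = ≡-dec _≟ᵇ_

Nonempty-of-size : ∀ {k j} {p : Subset k} → 1 ≤ j → ∣ p ∣ ≡ j → Nonempty p
Nonempty-of-size {k} {p = p} (s≤s z≤n) |p| with nonempty? p
... | yes p≠∅ = p≠∅
... | no  p=∅ = contradiction (trans (sym (∣⊥∣≡0 k)) (trans (cong ∣_∣ (sym (Empty-unique p=∅))) |p|)) λ ()

∃-⊆-of-size-pred : ∀ {k j} (p : Subset k) → ∣ p ∣ ≡ suc j → ∃ λ σ → σ ⊆ p × ∣ σ ∣ ≡ j
∃-⊆-of-size-pred (inside  ∷ p) |p| = outside ∷ p , out⊆ ⊆-refl , suc-injective |p|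
∃-⊆-of-size-pred (outside ∷ p) |p| =
  let σ , σ⊆p , |σ| = ∃-⊆-of-size-pred p |p| in outside ∷ σ , out⊆ σ⊆p , |σ|

subsets : ∀ k → List (Subset k)
subsets zero    = [] ∷ []
subsets (suc k) = map (inside ∷_) (subsets k) ++ map (outside ∷_) (subsets k)

∈-subsets : ∀ {k} (p : Subset k) → p ∈ subsets k
∈-subsets []            = here refl
∈-subsets (inside  ∷ p) = ∈-++⁺ˡ (∈-map⁺ (inside ∷_) (∈-subsets p))
∈-subsets (outside ∷ p) = ∈-++⁺ʳ (map (inside ∷_) (subsets _)) (∈-map⁺ (outside ∷_) (∈-subsets p))

Within : ∀ {A : Set} → Pred A 0ℓ → Rel A 0ℓ → Rel A 0ℓ
Within P R x y = P x × P y × R x y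

Within-sym : ∀ {A : Set} {P : Pred A 0ℓ} {R : Rel A 0ℓ} → Symmetric R → Sym (Within P R) (Within P R)
Within-sym R-sym (Px , Py , xRy) = Py , Px , R-sym xRy

module Routes {A B : Set} (_≟ᴬ_ : DecidableEquality A) (_≟ᴮ_ : DecidableEquality B)
              (_◃_ : A → B → Set) where

  open DecMembership _≟ᴬ_ using () renaming (_∈?_ to _∈ᴬ?_)
  open DecMembership _≟ᴮ_ using () renaming (_∈?_ to _∈ᴮ?_)

  data Route : A → A → Set where
    []  : ∀ {a} → Route a a
    hop : ∀ {a b c} η → a ◃ η → b ◃ η → Route b c → Route a c

  vertices : ∀ {a c} → Route a c → List A
  vertices {a} []            = a ∷ []
  vertices {a} (hop _ _ _ p) = a ∷ vertices p

  edges : ∀ {a c} → Route a c → List B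
  edges []            = []
  edges (hop η _ _ p) = η ∷ edges p

  IsSimple : ∀ {a c} → Route a c → Set
  IsSimple []                = ⊤
  IsSimple {a} (hop η _ _ p) = a ∉ vertices p × η ∉ edges p × IsSimple p

  SimpleRoute : A → A → Set
  SimpleRoute a c = Σ (Route a c) IsSimple

  start∈vertices : ∀ {a c} (p : Route a c) → a ∈ vertices p
  start∈vertices []            = here refl
  start∈vertices (hop _ _ _ _) = here refl

  suffix-from : ∀ {a b c} (p : Route a c) → IsSimple p → b ∈ vertices p → SimpleRoute b c
  suffix-from []              _           (here refl) = [] , tt
  suffix-from []              _           (there ())
  suffix-from p@(hop _ _ _ _) s           (here refl) = p , s
  suffix-from (hop _ _ _ p)   (_ , _ , s) (there b∈p) = suffix-from p s b∈p

  suffix-after : ∀ {a c η} (p : Route a c) → IsSimple p → η ∈ edges p →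
                 ∃₂ λ b (q : Route b c) → b ◃ η × η ∉ edges q × IsSimple q × vertices q ⊆ᴸ vertices p
  suffix-after (hop _ _ b◃η p) (_ , η∉p , s) (here refl) = _ , p , b◃η , η∉p , s , there
  suffix-after (hop _ _ _ p)   (_ , _ , s)   (there η∈p) =
    let b , q , b◃η , η∉q , sq , q⊆p = suffix-after p s η∈p in b , q , b◃η , η∉q , sq , there ∘ q⊆p

  -- A repeated vertex is cut out; a repeated edge η is crossed only once, by jumping
  -- straight to the vertex where the later crossing of η leaves it.
  cons : ∀ {a b c η} → a ◃ η → b ◃ η → SimpleRoute b c → SimpleRoute a c
  cons {a} {η = η} a◃η b◃η (p , s) with a ∈ᴬ? vertices p | η ∈ᴮ? edges p
  ... | yes a∈p | _       = suffix-from p s a∈p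
  ... | no  a∉p | yes η∈p =
    let b′ , q , b′◃η , η∉q , sq , q⊆p = suffix-after p s η∈p in hop η a◃η b′◃η q , a∉p ∘ q⊆p , η∉q , sq
  ... | no  a∉p | no  η∉p = hop η a◃η b◃η p , a∉p , η∉p , s

  erase : ∀ {a c} → Route a c → SimpleRoute a c
  erase []                  = [] , tt
  erase (hop _ a◃η b◃η p) = cons a◃η b◃η (erase p)

  hops : ∀ {a c} → Route a c → ℕ
  hops []            = zero
  hops (hop _ _ _ p) = suc (hops p)

  vertexAt : ∀ {a c} (p : Route a c) → Fin (suc (hops p)) → A
  vertexAt {a} _          zero    = a
  vertexAt (hop _ _ _ p) (suc i) = vertexAt p i

  edgeAt : ∀ {a c} (p : Route a c) → Fin (hops p) → B
  edgeAt (hop η _ _ _) zero    = η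
  edgeAt (hop _ _ _ p) (suc i) = edgeAt p i

  vertexAt-∈ : ∀ {a c} (p : Route a c) i → vertexAt p i ∈ vertices p
  vertexAt-∈ p             zero    = start∈vertices p
  vertexAt-∈ (hop _ _ _ p) (suc i) = there (vertexAt-∈ p i)

  edgeAt-∈ : ∀ {a c} (p : Route a c) i → edgeAt p i ∈ edges p
  edgeAt-∈ (hop _ _ _ _) zero    = here refl
  edgeAt-∈ (hop _ _ _ p) (suc i) = there (edgeAt-∈ p i)

  vertexAt-last : ∀ {a c} (p : Route a c) → vertexAt p (fromℕ (hops p)) ≡ c
  vertexAt-last []            = refl
  vertexAt-last (hop _ _ _ p) = vertexAt-last p

  vertexAt-left : ∀ {a c} (p : Route a c) k → vertexAt p (inject₁ k) ◃ edgeAt p k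
  vertexAt-left (hop _ a◃η _ _) zero    = a◃η
  vertexAt-left (hop _ _ _ p)   (suc k) = vertexAt-left p k

  vertexAt-right : ∀ {a c} (p : Route a c) k → vertexAt p (suc k) ◃ edgeAt p k
  vertexAt-right (hop _ _ b◃η _) zero    = b◃η
  vertexAt-right (hop _ _ _ p)   (suc k) = vertexAt-right p k

  vertexAt-step-≢ : ∀ {a c} (p : Route a c) → IsSimple p → ∀ k → vertexAt p (inject₁ k) ≢ vertexAt p (suc k)
  vertexAt-step-≢ (hop _ _ _ p) (a∉p , _) zero    a≡b = a∉p (subst (_∈ vertices p) (sym a≡b) (start∈vertices p))
  vertexAt-step-≢ (hop _ _ _ p) (_ , _ , s) (suc k) = vertexAt-step-≢ p s k

  vertexAt-injective : ∀ {a c} (p : Route a c) → IsSimple p → Injective _≡_ _≡_ (vertexAt p)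
  vertexAt-injective _             _           {zero}  {zero}  _ = refl
  vertexAt-injective (hop _ _ _ p) (a∉p , _)   {zero}  {suc j} e = ⊥-elim (a∉p (subst (_∈ vertices p) (sym e) (vertexAt-∈ p j)))
  vertexAt-injective (hop _ _ _ p) (a∉p , _)   {suc i} {zero}  e = ⊥-elim (a∉p (subst (_∈ vertices p) e (vertexAt-∈ p i)))
  vertexAt-injective (hop _ _ _ p) (_ , _ , s) {suc i} {suc j} e = cong suc (vertexAt-injective p s e)

  edgeAt-injective : ∀ {a c} (p : Route a c) → IsSimple p → Injective _≡_ _≡_ (edgeAt p)
  edgeAt-injective (hop _ _ _ _) _           {zero}  {zero}  _ = refl
  edgeAt-injective (hop _ _ _ p) (_ , η∉p , _) {zero}  {suc j} e = ⊥-elim (η∉p (subst (_∈ edges p) (sym e) (edgeAt-∈ p j)))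
  edgeAt-injective (hop _ _ _ p) (_ , η∉p , _) {suc i} {zero}  e = ⊥-elim (η∉p (subst (_∈ edges p) e (edgeAt-∈ p i)))
  edgeAt-injective (hop _ _ _ p) (_ , _ , s)   {suc i} {suc j} e = cong suc (edgeAt-injective p s e)

module RidgeWalks {m : ℕ} (n : ℕ) (L : SimplexSet m) where

  Ridge : Subset m → Set
  Ridge σ = L σ × ∣ σ ∣ ≡ n

  Facet : Subset m → Set
  Facet η = L η × η IsDim n

  record _◃_ (σ η : Subset m) : Set where
    constructor incidence
    field
      ridge : Ridge σ
      facet : Facet η
      face  : σ ⊆ η

  open _◃_
  open Routes _≟ˢ_ _≟ˢ_ _◃_ public

  vertexAt-ridge : ∀ {a c} → Ridge a → (p : Route a c) → ∀ i → Ridge (vertexAt p i)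
  vertexAt-ridge ra _                 zero    = ra
  vertexAt-ridge _  (hop _ _ b◃η p) (suc i) = vertexAt-ridge (ridge b◃η) p i

  simple⇒PathBetween : ∀ {a b} → Ridge a → (p : Route a b) → IsSimple p → PathBetween n L a b
  simple⇒PathBetween ra p s = walk , (vertexAt-injective p s , edgeAt-injective p s) , refl , vertexAt-last p
    where
    walk : Walk n L
    walk = record
      { r      = hops p
      ; σ      = vertexAt p
      ; η      = edgeAt p
      ; σ∈L    = proj₁ ∘ vertexAt-ridge ra p
      ; σdim   = proj₂ ∘ vertexAt-ridge ra p
      ; η∈L    = proj₁ ∘ facet ∘ vertexAt-left p
      ; ηdim   = proj₂ ∘ facet ∘ vertexAt-left p
      ; step≢  = vertexAt-step-≢ p s
      ; left⊆  = face ∘ vertexAt-left p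
      ; right⊆ = face ∘ vertexAt-right p
      }

  route⇒PathBetween : ∀ {a b} → Ridge a → Route a b → PathBetween n L a b
  route⇒PathBetween ra p = let q , s = erase p in simple⇒PathBetween ra q s

module Components {A : Set} (_~_ : Rel A 0ℓ) (_~?_ : Decidable₂ _~_) (~-sym : Symmetric _~_) where

  Touches : A → Pred (List A) 0ℓ
  Touches y = Any (_~ y)

  touches? : ∀ y → Decidable (Touches y)
  touches? y = any? (_~? y)

  components : List A → List (List A)
  components []       = []
  components (y ∷ xs) = (y ∷ concat (filter (touches? y) (components xs)))
                      ∷ filter (¬? ∘ touches? y) (components xs)

  Linked : List A → Rel A 0ℓ
  Linked C = Star (Within (_∈ C) _~_)

  record AreComponentsOf (xs : List A) (cs : List (List A)) : Set where
    field
      cover    : ∀ {x} → x ∈ xs → ∃ λ C → C ∈ cs × x ∈ C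
      sound    : ∀ {C x} → C ∈ cs → x ∈ C → x ∈ xs
      nonempty : ∀ {C} → C ∈ cs → ∃ (_∈ C)
      disjoint : AllPairs Disjoint cs
      closed   : ∀ {C x y} → C ∈ cs → x ∈ C → y ∈ xs → x ~ y → y ∈ C
      linked   : ∀ {C x y} → C ∈ cs → x ∈ C → y ∈ C → Linked C x y

    closed-along : ∀ {C D x y} → C ∈ cs → D ∈ cs → Linked C x y → x ∈ D → y ∈ D
    closed-along C∈cs D∈cs ε               x∈D = x∈D
    closed-along C∈cs D∈cs ((_ , z∈C , x~z) ◅ z⇝y) x∈D =
      closed-along C∈cs D∈cs z⇝y (closed D∈cs x∈D (sound C∈cs z∈C) x~z)

  module Insert (y : A) (y~y : y ~ y) {xs : List A} {cs : List (List A)} (I : AreComponentsOf xs cs) where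
    open AreComponentsOf I

    touching others cs′ : List (List A)
    new : List A
    touching = filter (touches? y) cs
    others   = filter (¬? ∘ touches? y) cs
    new      = y ∷ concat touching
    cs′      = new ∷ others

    ∈-touching⁻ : ∀ {C} → C ∈ touching → C ∈ cs × Touches y C
    ∈-touching⁻ = ∈-filter⁻ (touches? y)

    ∈-others⁻ : ∀ {C} → C ∈ others → C ∈ cs × ¬ Touches y C
    ∈-others⁻ = ∈-filter⁻ (¬? ∘ touches? y)

    ∈-touching⊎others : ∀ {C} → C ∈ cs → C ∈ touching ⊎ C ∈ others
    ∈-touching⊎others {C} C∈cs with touches? y C
    ... | yes t = inj₁ (∈-filter⁺ (touches? y) C∈cs t)
    ... | no ¬t = inj₂ (∈-filter⁺ (¬? ∘ touches? y) C∈cs ¬t)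

    ∈-new⁺ : ∀ {C x} → C ∈ touching → x ∈ C → x ∈ new
    ∈-new⁺ C∈t x∈C = there (∈-concat⁺′ x∈C C∈t)

    ∈-new⁻ : ∀ {x} → x ∈ new → x ≡ y ⊎ ∃ λ C → C ∈ touching × x ∈ C
    ∈-new⁻ (here x≡y)  = inj₁ x≡y
    ∈-new⁻ (there x∈c) = let C , x∈C , C∈t = ∈-concat⁻′ touching x∈c in inj₂ (C , C∈t , x∈C)

    cover′ : ∀ {x} → x ∈ y ∷ xs → ∃ λ C → C ∈ cs′ × x ∈ C
    cover′ (here x≡y)   = _ , here refl , here x≡y
    cover′ (there x∈xs) with cover x∈xs
    ... | C , C∈cs , x∈C with ∈-touching⊎others C∈cs
    ... | inj₁ C∈t = _ , here refl , ∈-new⁺ C∈t x∈C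
    ... | inj₂ C∈o = C , there C∈o , x∈C

    sound′ : ∀ {C x} → C ∈ cs′ → x ∈ C → x ∈ y ∷ xs
    sound′ (here refl) x∈new with ∈-new⁻ x∈new
    ... | inj₁ x≡y              = here x≡y
    ... | inj₂ (C , C∈t , x∈C) = there (sound (proj₁ (∈-touching⁻ C∈t)) x∈C)
    sound′ (there C∈o) x∈C = there (sound (proj₁ (∈-others⁻ C∈o)) x∈C)

    nonempty′ : ∀ {C} → C ∈ cs′ → ∃ (_∈ C)
    nonempty′ (here refl) = y , here refl
    nonempty′ (there C∈o) = nonempty (proj₁ (∈-others⁻ C∈o))

    new-disjoint : ∀ {D} → D ∈ others → Disjoint new D
    new-disjoint D∈o (x∈new , x∈D) with ∈-others⁻ D∈o | ∈-new⁻ x∈new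
    ... | _ , ¬t | inj₁ refl = ¬t (lose x∈D y~y)
    ... | D∈cs , ¬t | inj₂ (C , C∈t , x∈C) with ∈-touching⁻ C∈t
    ... | C∈cs , t with find t
    ... | z , z∈C , z~y = ¬t (lose (closed-along C∈cs D∈cs (linked C∈cs x∈C z∈C) x∈D) z~y)

    disjoint′ : AllPairs Disjoint cs′
    disjoint′ = All.tabulate new-disjoint ∷ AllPairs.filter⁺ (¬? ∘ touches? y) disjoint

    closed′ : ∀ {C x z} → C ∈ cs′ → x ∈ C → z ∈ y ∷ xs → x ~ z → z ∈ C
    closed′ (here refl) _ (here z≡y) _ = here z≡y
    closed′ (here refl) x∈new (there z∈xs) x~z with ∈-new⁻ x∈new
    ... | inj₂ (C , C∈t , x∈C) = ∈-new⁺ C∈t (closed (proj₁ (∈-touching⁻ C∈t)) x∈C z∈xs x~z)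
    ... | inj₁ refl with cover z∈xs
    ... | D , D∈cs , z∈D with ∈-touching⊎others D∈cs
    ... | inj₁ D∈t = ∈-new⁺ D∈t z∈D
    ... | inj₂ D∈o = ⊥-elim (proj₂ (∈-others⁻ D∈o) (lose z∈D (~-sym x~z)))
    closed′ (there C∈o) x∈C (here refl)  x~y = ⊥-elim (proj₂ (∈-others⁻ C∈o) (lose x∈C x~y))
    closed′ (there C∈o) x∈C (there z∈xs) x~z = closed (proj₁ (∈-others⁻ C∈o)) x∈C z∈xs x~z

    linked-to-y : ∀ {x} → x ∈ new → Linked new x y
    linked-to-y x∈new with ∈-new⁻ x∈new
    ... | inj₁ refl = ε
    ... | inj₂ (C , C∈t , x∈C) with ∈-touching⁻ C∈t
    ... | C∈cs , t with find t
    ... | z , z∈C , z~y =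
      Star.map (λ (u∈C , v∈C , u~v) → ∈-new⁺ C∈t u∈C , ∈-new⁺ C∈t v∈C , u~v) (linked C∈cs x∈C z∈C)
      ◅◅ (∈-new⁺ C∈t z∈C , here refl , z~y) ◅ ε

    linked′ : ∀ {C x z} → C ∈ cs′ → x ∈ C → z ∈ C → Linked C x z
    linked′ (here refl) x∈new z∈new = linked-to-y x∈new ◅◅ Star.reverse (Within-sym {P = _∈ _} ~-sym) (linked-to-y z∈new)
    linked′ (there C∈o) x∈C z∈C     = linked (proj₁ (∈-others⁻ C∈o)) x∈C z∈C

    insert-correct : AreComponentsOf (y ∷ xs) cs′
    insert-correct = record
      { cover = cover′ ; sound = sound′ ; nonempty = nonempty′ ; disjoint = disjoint′
      ; closed = closed′ ; linked = linked′ }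

  components-correct : ∀ xs → (∀ {x} → x ∈ xs → x ~ x) → AreComponentsOf xs (components xs)
  components-correct []       _      = record
    { cover = λ () ; sound = λ () ; nonempty = λ () ; disjoint = [] ; closed = λ () ; linked = λ () }
  components-correct (y ∷ xs) ~-refl =
    Insert.insert-correct y (~-refl (here refl)) (components-correct xs (~-refl ∘ there))

lookup-disjoint : ∀ {A : Set} {cs : List (List A)} {x} → AllPairs Disjoint cs →
                  ∀ i j → x ∈ lookup cs i → x ∈ lookup cs j → i ≡ j
lookup-disjoint (_ ∷ _)       zero    zero    _   _   = refl
lookup-disjoint (C#cs ∷ _)    zero    (suc j) x∈C x∈D = ⊥-elim (All.lookup C#cs (∈-lookup j) (x∈C , x∈D))
lookup-disjoint (C#cs ∷ _)    (suc i) zero    x∈D x∈C = ⊥-elim (All.lookup C#cs (∈-lookup i) (x∈C , x∈D))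
lookup-disjoint (_ ∷ cs-disj) (suc i) (suc j) x∈C x∈D = cong suc (lookup-disjoint cs-disj i j x∈C x∈D)

ShareRidge : ∀ {m} → ℕ → Rel (Subset m) 0ℓ
ShareRidge n x y = ∃ λ σ → ∣ σ ∣ ≡ n × σ ⊆ x × σ ⊆ y

shareRidge? : ∀ {m} n → Decidable₂ (ShareRidge {m} n)
shareRidge? n x y = anySubset? λ σ → (∣ σ ∣ ≟ n) ×-dec (σ ⊆? x) ×-dec (σ ⊆? y)

ShareRidge-sym : ∀ {m n} → Symmetric (ShareRidge {m} n)
ShareRidge-sym (σ , |σ| , σ⊆x , σ⊆y) = σ , |σ| , σ⊆y , σ⊆x

ShareRidge-refl : ∀ {m n} {x : Subset m} → x IsDim n → ShareRidge n x x
ShareRidge-refl {x = x} |x| = let σ , σ⊆x , |σ| = ∃-⊆-of-size-pred x |x| in σ , |σ| , σ⊆x , σ⊆x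

module ClosureOfFacets {m n : ℕ} (1≤n : 1 ≤ n) {S : SimplexSet m} (S-dim : ∀ {x} → S x → x IsDim n) where

  S⊆closure : ∀ {x} → S x → closure S x
  S⊆closure Sx = Nonempty-of-size (s≤s z≤n) (S-dim Sx) , _ , Sx , ⊆-refl

  closure-subcomplex : ∀ {K} → IsClosedFamily K → (∀ {x} → S x → K x) → IsSubcomplex (closure S) K
  closure-subcomplex (_ , K-faces) S⊆K =
    ((λ _ → proj₁) , λ { σ τ (_ , ζ , Sζ , σ⊆ζ) τ≠∅ τ⊆σ → τ≠∅ , ζ , Sζ , ⊆-trans τ⊆σ σ⊆ζ }) ,
    λ { σ (σ≠∅ , ζ , Sζ , σ⊆ζ) → K-faces ζ σ (S⊆K Sζ) σ≠∅ σ⊆ζ }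

  closure-pure : ∃ S → IsPure n (closure S)
  closure-pure (x , Sx) =
    ((x , S⊆closure Sx , S-dim Sx) , size≤) , λ { σ (_ , ζ , Sζ , σ⊆ζ) → ζ , S⊆closure Sζ , S-dim Sζ , σ⊆ζ }
    where
    size≤ : ∀ σ → closure S σ → ∣ σ ∣ ≤ suc n
    size≤ σ (_ , ζ , Sζ , σ⊆ζ) = ≤-trans (p⊆q⇒∣p∣≤∣q∣ σ⊆ζ) (≤-reflexive (S-dim Sζ))

  open RidgeWalks n (closure S)

  face◃ : ∀ {σ ζ} → S ζ → σ ⊆ ζ → ∣ σ ∣ ≡ n → σ ◃ ζ
  face◃ Sζ σ⊆ζ |σ| = incidence ((Nonempty-of-size 1≤n |σ| , _ , Sζ , σ⊆ζ) , |σ|) (S⊆closure Sζ , S-dim Sζ) σ⊆ζ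

  chain⇒route : ∀ {a b ζ ζ′} → Star (Within S (ShareRidge n)) ζ ζ′ → a ◃ ζ → b ◃ ζ′ → Route a b
  chain⇒route ε a◃ζ b◃ζ = hop _ a◃ζ b◃ζ []
  chain⇒route ((Sζ , Sζ′ , τ , |τ| , τ⊆ζ , τ⊆ζ′) ◅ ζ′⇝ζ″) a◃ζ b◃ζ″ =
    hop _ a◃ζ (face◃ Sζ τ⊆ζ |τ|) (chain⇒route ζ′⇝ζ″ (face◃ Sζ′ τ⊆ζ′ |τ|) b◃ζ″)

  closure-connected : (∀ {x y} → S x → S y → Star (Within S (ShareRidge n)) x y) → Connected n (closure S)
  closure-connected linked a b a∈ |a| (_ , ζ′ , Sζ′ , b⊆ζ′) |b| _ with a∈
  ... | _ , ζ , Sζ , a⊆ζ =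
    route⇒PathBetween (a∈ , |a|) (chain⇒route (linked Sζ Sζ′) (face◃ Sζ a⊆ζ |a|) (face◃ Sζ′ b⊆ζ′ |b|))

  walk-stays-in : ∀ {η} → (∀ {x} → S x → ¬ ShareRidge n x η) →
                  (w : Walk n (closure S ∪ₛ closure (singletonSet η))) → Walk.σ w zero ⊆ η → ∀ i → Walk.σ w i ⊆ η
  walk-stays-in {η} apart w σ₀⊆η = <-weakInduction (λ i → σ i ⊆ η) σ₀⊆η step
    where
    open Walk w using (σ; σdim; η∈L; left⊆; right⊆)
    step : ∀ k → σ (inject₁ k) ⊆ η → σ (suc k) ⊆ η
    step k σₖ⊆η with η∈L k
    ... | inj₂ (_ , _ , refl , ηₖ⊆η) = ⊆-trans (right⊆ k) ηₖ⊆η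
    ... | inj₁ (_ , ζ , Sζ , ηₖ⊆ζ)    =
      ⊥-elim (apart Sζ (σ (inject₁ k) , σdim (inject₁ k) , ⊆-trans (left⊆ k) ηₖ⊆ζ , σₖ⊆η))

  closure-maximal : ∀ {K : SimplexSet m} → ∃ S → (∀ {x η} → S x → K η → η IsDim n → ShareRidge n x η → S η) →
                    ∀ η → K η → η IsDim n → ¬ closure S η → ¬ Connected n (closure S ∪ₛ closure (singletonSet η))
  closure-maximal (x₀ , Sx₀) S-closed η Kη |η| η∉ connected
    with ∃-⊆-of-size-pred η |η| | ∃-⊆-of-size-pred x₀ (S-dim Sx₀)
  ... | a , a⊆η , |a| | b , b⊆x₀ , |b| = apart Sx₀ (b , |b| , b⊆x₀ , subst (_⊆ η) ends-at-b (within-η (fromℕ _)))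
    where
    apart : ∀ {x} → S x → ¬ ShareRidge n x η
    apart Sx share = η∉ (S⊆closure (S-closed Sx Kη |η| share))

    a≢b : a ≢ b
    a≢b refl = apart Sx₀ (a , |a| , b⊆x₀ , a⊆η)

    path : PathBetween n (closure S ∪ₛ closure (singletonSet η)) a b
    path = connected a b (inj₂ (Nonempty-of-size 1≤n |a| , η , refl , a⊆η)) |a|
                         (inj₁ (Nonempty-of-size 1≤n |b| , x₀ , Sx₀ , b⊆x₀)) |b| a≢b

    walk : Walk n (closure S ∪ₛ closure (singletonSet η))
    walk = proj₁ path

    starts-at-a : Walk.σ walk zero ≡ a
    starts-at-a = proj₁ (proj₂ (proj₂ path))

    ends-at-b : Walk.σ walk (fromℕ (Walk.r walk)) ≡ b
    ends-at-b = proj₂ (proj₂ (proj₂ path))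

    within-η : ∀ i → Walk.σ walk i ⊆ η
    within-η = walk-stays-in apart walk (subst (_⊆ η) (sym starts-at-a) a⊆η)

  closure-component : ∀ {K} → IsClosedFamily K → (∀ {x} → S x → K x) → ∃ S →
                      (∀ {x y} → S x → S y → Star (Within S (ShareRidge n)) x y) →
                      (∀ {x η} → S x → K η → η IsDim n → ShareRidge n x η → S η) →
                      IsComponent n K (closure S)
  closure-component K-closed S⊆K S≠∅ linked S-closed =
    closure-subcomplex K-closed S⊆K , closure-pure S≠∅ , closure-connected linked , closure-maximal S≠∅ S-closed

module FacetClasses {m : ℕ} (n : ℕ) (K : SimplexSet m) (K? : Decidable K) where

  open Components (ShareRidge {m} n) (shareRidge? n) ShareRidge-sym

  nSimplices? : Decidable (nSimplices n K)
  nSimplices? σ = K? σ ×-dec (∣ σ ∣ ≟ suc n)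

  facets : List (Subset m)
  facets = filter nSimplices? (subsets m)

  ∈-facets⁺ : ∀ {x} → nSimplices n K x → x ∈ facets
  ∈-facets⁺ {x} = ∈-filter⁺ nSimplices? (∈-subsets x)

  ∈-facets⁻ : ∀ {x} → x ∈ facets → nSimplices n K x
  ∈-facets⁻ = proj₂ ∘ ∈-filter⁻ nSimplices? {xs = subsets m}

  classes : List (List (Subset m))
  classes = components facets

  open AreComponentsOf (components-correct facets (λ x∈ → ShareRidge-refl (proj₂ (∈-facets⁻ x∈))))

  block : Fin (length classes) → SimplexSet m
  block i x = x ∈ lookup classes i

  block-partition : IsPartition (nSimplices n K) (length classes) block
  block-partition =
    (λ i → nonempty (∈-lookup i)) ,
    (λ i x x∈block → ∈-facets⁻ (sound (∈-lookup i) x∈block)) ,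
    (λ x x∈Kⁿ → let C , C∈ , x∈C = cover (∈-facets⁺ x∈Kⁿ) in
                Any.index C∈ , subst (x ∈_) (lookup-index C∈) x∈C) ,
    (λ i j x → lookup-disjoint disjoint i j)

  block-component : 1 ≤ n → IsClosedFamily K → ∀ i → IsComponent n K (closure (block i))
  block-component 1≤n K-closed i =
    closure-component K-closed (λ x∈C → proj₁ (facet x∈C)) (nonempty C∈) (linked C∈)
                      (λ x∈C Kη |η| share → closed C∈ x∈C (∈-facets⁺ (Kη , |η|)) share)
    where
    C∈ : lookup classes i ∈ classes
    C∈ = ∈-lookup i

    facet : ∀ {x} → x ∈ lookup classes i → nSimplices n K x
    facet = ∈-facets⁻ ∘ sound C∈

    open ClosureOfFacets 1≤n {S = _∈ lookup classes i} (proj₂ ∘ facet)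

proposition3p2 : ∀ {m : ℕ} (n : ℕ) → 1 ≤ n → (K : SimplexSet m) → Decidable K →
    IsSimplicialComplex K → IsPure n K →
    Σ ℕ λ k → Σ (Fin k → SimplexSet m) λ L →
      IsPartition (nSimplices n K) k L × (∀ i → IsComponent n K (closure (L i)))
proposition3p2 n 1≤n K K? (K-closed , _) _ =
  length classes , block , block-partition , block-component 1≤n K-closed
  where open FacetClasses n K K?
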